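{- For positive integers $n$ and $r$, $\varphi(K_n^r)=\frac{1}{2}(n-1)(n-2)$, where $K_n$ is the complete graph on $n$ vertices.
   Context: All graphs are simple and finite. $\mathbb{N}_0$ denotes the set of non-negative integers. For non-empty $A,B\subseteq\mathbb{N}_0$, $A+B=\{a+b: a\in A, b\in B\}$. An integer additive set-indexer (IASI) of a graph $G$ is an injective function $f:V(G)\to\mathcal{P}(\mathbb{N}_0)$ with non-empty values such that the induced map $f^+(uv)=f(u)+f(v)$ on $E(G)$ is also injective. An IASI is weak if $|f^+(uv)|=\max(|f(u)|,|f(v)|)$ for every edge $uv$. An element (vertex or edge) is mono-indexed if its set-label has cardinality $1$. The sparing number $\varphi(H)$ of a graph $H$ is the minimum number of mono-indexed edges over all weak IASIs of $H$. The $r$-th power $G^r$ of $G$ has vertex set $V(G)$, two distinct vertices adjacent iff their distance in $G$ is at most $r$. -}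

module Defs where

open import Level using (Level; 0ℓ) renaming (suc to lsuc)
open import Data.Nat using (ℕ; zero; suc; _+_; _≤_; _⊔_)
open import Data.Fin using (Fin) renaming (_<_ to _<ᶠ_)
open import Data.List using (List; length)
open import Data.List.Membership.Propositional using (_∈_)
open import Data.List.Relation.Unary.Unique.Propositional using (Unique)
open import Data.Product using (Σ; ∃; ∃-syntax; _×_; _,_)
open import Data.Sum using (_⊎_)
open import Relation.Binary.PropositionalEquality using (_≡_; _≢_; refl)
open import Relation.Nullary using (¬_)

NSet : Set₁
NSet = ℕ → Set

_≐_ : NSet → NSet → Set
A ≐ B = ∀ x → (A x → B x) × (B x → A x)

_⊕_ : NSet → NSet → NSet
(A ⊕ B) x = ∃[ a ] ∃[ b ] (A a × B b × x ≡ a + b)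

HasSize : NSet → ℕ → Set
HasSize A k = Σ (List ℕ) λ xs → Unique xs × length xs ≡ k × (∀ x → (x ∈ xs → A x) × (A x → x ∈ xs))

record Graph (n : ℕ) : Set₁ where
  field
    Adj    : Fin n → Fin n → Set
    sym    : ∀ {u v} → Adj u v → Adj v u
    irrefl : ∀ {u} → ¬ Adj u u
open Graph public

K : (n : ℕ) → Graph n
K n = record { Adj = λ u v → u ≢ v ; sym = λ p q → p (sym≡ q) ; irrefl = λ p → p refl }
  where
  sym≡ : ∀ {u v : Fin n} → u ≡ v → v ≡ u
  sym≡ refl = refl

data Walk {n : ℕ} (G : Graph n) : Fin n → Fin n → ℕ → Set where
  here : ∀ {u} → Walk G u u zero
  step : ∀ {u w v k} → Adj G u w → Walk G w v k → Walk G u v (suc k)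

snocWalk : ∀ {n} {G : Graph n} {u w v k} → Walk G u w k → Adj G w v → Walk G u v (suc k)
snocWalk here e = step e here
snocWalk (step a p) e = step a (snocWalk p e)

revWalk : ∀ {n} {G : Graph n} {u v k} → Walk G u v k → Walk G v u k
revWalk here = here
revWalk {G = G} (step a p) = snocWalk (revWalk p) (Graph.sym G a)

-- r-th power: distinct u, v are adjacent iff dist_G(u,v) ≤ r,
-- i.e. iff there is a walk of length at most r between them.
Power : ∀ {n} → Graph n → ℕ → Graph n
Power {n} G r = record
  { Adj = λ u v → u ≢ v × ∃[ k ] (k ≤ r × Walk G u v k)
  ; sym = λ { (p , k , k≤r , w) → (λ q → p (sym≡ q)) , k , k≤r , revWalk w }
  ; irrefl = λ { (p , _) → p refl }
  }
  where
  sym≡ : ∀ {u v : Fin n} → u ≡ v → v ≡ u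
  sym≡ refl = refl

module _ {n : ℕ} (G : Graph n) (f : Fin n → NSet) where

  record IsIASI : Set where
    field
      nonEmptyFinite : ∀ v → ∃[ k ] HasSize (f v) (suc k)
      injective      : ∀ u v → f u ≐ f v → u ≡ v
      edgeInjective  : ∀ u v w x → Adj G u v → Adj G w x →
                       (f u ⊕ f v) ≐ (f w ⊕ f x) →
                       (u ≡ w × v ≡ x) ⊎ (u ≡ x × v ≡ w)

  record IsWeakIASI : Set where
    field
      iasi : IsIASI
      weak : ∀ u v → Adj G u v → ∀ a b → HasSize (f u) a → HasSize (f v) b →
             HasSize (f u ⊕ f v) (a ⊔ b)

  MonoEdge : Fin n → Fin n → Set
  MonoEdge u v = HasSize (f u ⊕ f v) 1

  MonoCount : ℕ → Set
  MonoCount m = Σ (List (Fin n × Fin n)) λ es → Unique es × length es ≡ m ×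
    (∀ u v → ((u , v) ∈ es → (u <ᶠ v × Adj G u v × MonoEdge u v)) ×
             ((u <ᶠ v × Adj G u v × MonoEdge u v) → (u , v) ∈ es))

SparingNumber : ∀ {n} → Graph n → ℕ → Set₁
SparingNumber {n} G m =
  (∃[ f ] (IsWeakIASI G f × MonoCount G f m)) ×
  (∀ (f : Fin n → NSet) m′ → IsWeakIASI G f → MonoCount G f m′ → m ≤ m′)

module Submission where

-- φ(K_n^r) = (n-1)(n-2)/2.  For r ≥ 1, K_n^r is complete, so it suffices to
-- show that every complete graph on m + 1 vertices has sparing number
-- pairCount m = m(m-1)/2, the number of edges among m vertices.
--
-- Lower bound: if |A| ≥ |B| and B contains b₀ < b₁, then A + b₀ together with
-- max A + b₁ are |A| + 1 elements of A + B.  So a weak IASI never gives two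
-- adjacent vertices labels of size ≥ 2; in a complete graph all vertices but
-- one, b, are mono-indexed, and the pairCount m edges avoiding b are too.
--
-- Upper bound: label vertex 0 by {1, 2} and vertex v ≥ 1 by {2^v}.  Labels and
-- edge labels are determined by their minima 2^v and 2^u + 2^v (powers of two
-- form a Sidon set), and exactly the edges avoiding vertex 0 are mono-indexed.

open import Defs
open import Data.Nat using (ℕ; _∸_; _*_; _/_; _≥_)

open import Data.Nat
  using (zero; suc; _+_; _^_; _≤_; _<_; _⊔_; _≤?_; z≤n; s≤s; s≤s⁻¹)
open import Data.Nat.Properties
open import Data.Nat.DivMod using (m*n/n≡m)
open import Data.Nat.Tactic.RingSolver using (solve-∀)
open import Data.Fin using (Fin; toℕ; punchIn) renaming (zero to fzero; suc to fsuc; _<_ to _<ᶠ_)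
import Data.Fin.Properties as FinP
open import Data.List using (List; []; _∷_; length; map; _++_; allFin)
open import Data.List.Properties using (length-map; length-++; length-tabulate; length-removeAt′)
open import Data.List.Membership.Propositional using (_∈_)
open import Data.List.Membership.Propositional.Properties
  using (∈-map⁻; ∈-map⁺; ∈-++⁻; ∈-++⁺ˡ; ∈-++⁺ʳ; ∈-allFin)
open import Data.List.Relation.Unary.Any using (here; there; _─_)
open import Data.List.Relation.Unary.All using ([]; _∷_)
import Data.List.Relation.Unary.All as All
open import Data.List.Relation.Unary.AllPairs using ([]; _∷_)
open import Data.List.Relation.Unary.Unique.Propositional using (Unique)
import Data.List.Relation.Unary.Unique.Propositional.Properties as UniqueP
open import Data.Product using (Σ; ∃-syntax; _×_; _,_; proj₁; proj₂)
open import Data.Sum using (_⊎_; inj₁; inj₂)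
open import Data.Empty using (⊥; ⊥-elim)
open import Relation.Nullary using (¬_; yes; no)
open import Relation.Binary using (tri<; tri≈; tri>)
open import Relation.Binary.PropositionalEquality using (_≡_; _≢_; refl; cong; cong₂; trans; subst; subst₂)
import Relation.Binary.PropositionalEquality as ≡

∈-─ : ∀ {A : Set} {x y : A} (ys : List A) (p : x ∈ ys) → y ∈ ys → y ≢ x → y ∈ (ys ─ p)
∈-─ (_ ∷ _)  (here refl) (here refl) y≢x = ⊥-elim (y≢x refl)
∈-─ (_ ∷ _)  (here refl) (there q)   _   = q
∈-─ (_ ∷ _)  (there p)   (here refl) _   = here refl
∈-─ (_ ∷ ys) (there p)   (there q)   y≢x = there (∈-─ ys p q y≢x)

unique-⊆⇒length≤ : ∀ {A : Set} (xs ys : List A) → Unique xs →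
                   (∀ {z} → z ∈ xs → z ∈ ys) → length xs ≤ length ys
unique-⊆⇒length≤ []       ys _             _   = z≤n
unique-⊆⇒length≤ (x ∷ xs) ys (x∉xs ∷ uxs) xs⊆ys =
  subst (suc (length xs) ≤_) (≡.sym (length-removeAt′ ys _))
    (s≤s (unique-⊆⇒length≤ xs (ys ─ x∈ys) uxs
      (λ z∈xs → ∈-─ ys x∈ys (xs⊆ys (there z∈xs)) (λ z≡x → All.lookup x∉xs z∈xs (≡.sym z≡x)))))
  where
  x∈ys = xs⊆ys (here refl)

size-lowerBound : ∀ {S : NSet} {k} → HasSize S k → (L : List ℕ) → Unique L →
                  (∀ {z} → z ∈ L → S z) → length L ≤ k
size-lowerBound (ys , _ , refl , enum) L uL L⊆S =
  unique-⊆⇒length≤ L ys uL (λ {z} z∈L → proj₂ (enum z) (L⊆S z∈L))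

size-unique : ∀ {S : NSet} {a b} → HasSize S a → HasSize S b → a ≡ b
size-unique sa@(xs , uxs , refl , ea) sb@(ys , uys , refl , eb) =
  ≤-antisym (size-lowerBound sb xs uxs (λ {z} → proj₁ (ea z)))
            (size-lowerBound sa ys uys (λ {z} → proj₁ (eb z)))

size-resp-≐ : ∀ {A B : NSet} {k} → A ≐ B → HasSize A k → HasSize B k
size-resp-≐ A≐B (xs , uxs , len , enum) =
  xs , uxs , len , λ x → (λ x∈xs → proj₁ (A≐B x) (proj₁ (enum x) x∈xs))
                       , (λ Bx → proj₂ (enum x) (proj₂ (A≐B x) Bx))

singleton-size : ∀ c → HasSize (λ y → y ≡ c) 1
singleton-size c = c ∷ [] , [] ∷ [] , refl ,
  λ y → (λ { (here refl) → refl }) , (λ { refl → here refl })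

pair-size : ∀ c d → c ≢ d → HasSize (λ y → y ≡ c ⊎ y ≡ d) 2
pair-size c d c≢d = c ∷ d ∷ [] , (c≢d ∷ []) ∷ [] ∷ [] , refl ,
  λ y → (λ { (here refl) → inj₁ refl ; (there (here refl)) → inj₂ refl })
      , (λ { (inj₁ refl) → here refl ; (inj₂ refl) → there (here refl) })

two-elements : ∀ {A : NSet} {k} → HasSize A (suc (suc k)) → ∃[ b₀ ] ∃[ b₁ ] (b₀ < b₁ × A b₀ × A b₁)
two-elements (x ∷ y ∷ _ , (x∉ ∷ _) , _ , enum) with <-cmp x y
... | tri< x<y _ _ = x , y , x<y , proj₁ (enum x) (here refl) , proj₁ (enum y) (there (here refl))
... | tri≈ _ x≡y _ = ⊥-elim (All.lookup x∉ (here refl) x≡y)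
... | tri> _ _ y<x = y , x , y<x , proj₁ (enum y) (there (here refl)) , proj₁ (enum x) (here refl)

list-maximum : (x : ℕ) (xs : List ℕ) → ∃[ M ] (M ∈ (x ∷ xs) × (∀ {z} → z ∈ (x ∷ xs) → z ≤ M))
list-maximum x [] = x , here refl , λ { (here refl) → ≤-refl }
list-maximum x (y ∷ xs) with list-maximum y xs
... | M , M∈ , bound with x ≤? M
...   | yes x≤M = M , there M∈ , λ { (here refl) → x≤M ; (there z∈) → bound z∈ }
...   | no x≰M  = x , here refl , λ { (here refl) → ≤-refl
                                    ; (there z∈) → ≤-trans (bound z∈) (<⇒≤ (≰⇒> x≰M)) }

set-maximum : ∀ {A : NSet} {k} → HasSize A (suc k) → ∃[ M ] (A M × (∀ a → A a → a ≤ M))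
set-maximum (x ∷ xs , _ , _ , enum) with list-maximum x xs
... | M , M∈ , bound = M , proj₁ (enum M) M∈ , λ a Aa → bound (proj₂ (enum a) Aa)

⊕-comm : ∀ (A B : NSet) → (A ⊕ B) ≐ (B ⊕ A)
⊕-comm A B x = swap , swap
  where
  swap : ∀ {C D : NSet} → (C ⊕ D) x → (D ⊕ C) x
  swap (c , d , Cc , Dd , x≡c+d) = d , c , Dd , Cc , trans x≡c+d (+-comm c d)

⊕-singleton-size : ∀ {A : NSet} {k} c → HasSize A k → HasSize (A ⊕ (λ y → y ≡ c)) k
⊕-singleton-size {A} c (xs , uxs , len , enum) =
  map (_+ c) xs ,
  UniqueP.map⁺ (λ {a} {b} → +-cancelʳ-≡ c a b) uxs ,
  trans (length-map (_+ c) xs) len ,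
  λ y → (λ y∈ → let (a , a∈xs , y≡a+c) = ∈-map⁻ (_+ c) y∈ in a , c , proj₁ (enum a) a∈xs , refl , y≡a+c)
      , (λ { (a , _ , Aa , refl , refl) → ∈-map⁺ (_+ c) (proj₂ (enum a) Aa) })

-- If B has two elements b₀ < b₁, then A + B has more elements than A:
-- A + b₀ and the further element max A + b₁.
sumset-grows : ∀ {A B : NSet} {k s} → HasSize A (suc k) →
               ∀ {b₀ b₁} → b₀ < b₁ → B b₀ → B b₁ → HasSize (A ⊕ B) s → suc (suc k) ≤ s
sumset-grows {A} {B} {k} {s} sA@(xs , uxs , len , enum) {b₀} {b₁} b₀<b₁ Bb₀ Bb₁ sAB
  with set-maximum sA
... | M , AM , M-max =
  subst (_≤ s) (cong suc (trans (length-map (_+ b₀) xs) len))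
    (size-lowerBound sAB (M + b₁ ∷ map (_+ b₀) xs)
      (All.tabulate top-new ∷ UniqueP.map⁺ (λ {a} {b} → +-cancelʳ-≡ b₀ a b) uxs)
      in-sumset)
  where
  top-new : ∀ {z} → z ∈ map (_+ b₀) xs → M + b₁ ≢ z
  top-new z∈ with ∈-map⁻ (_+ b₀) z∈
  ... | a , a∈xs , refl = >⇒≢ (+-mono-≤-< (M-max a (proj₁ (enum a) a∈xs)) b₀<b₁)
  in-sumset : ∀ {z} → z ∈ (M + b₁ ∷ map (_+ b₀) xs) → (A ⊕ B) z
  in-sumset (here refl) = M , b₁ , AM , Bb₁ , refl
  in-sumset (there z∈) with ∈-map⁻ (_+ b₀) z∈
  ... | a , a∈xs , refl = a , b₀ , proj₁ (enum a) a∈xs , Bb₀ , refl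

IsMin : NSet → ℕ → Set
IsMin A a = A a × (∀ y → A y → a ≤ y)

min-unique : ∀ {A B : NSet} {a b} → A ≐ B → IsMin A a → IsMin B b → a ≡ b
min-unique A≐B (Aa , a-min) (Bb , b-min) =
  ≤-antisym (a-min _ (proj₂ (A≐B _) Bb)) (b-min _ (proj₁ (A≐B _) Aa))

min-⊕ : ∀ {A B : NSet} {a b} → IsMin A a → IsMin B b → IsMin (A ⊕ B) (a + b)
min-⊕ (Aa , a-min) (Bb , b-min) =
  (_ , _ , Aa , Bb , refl) , λ { _ (x , y , Ax , By , refl) → +-mono-≤ (a-min x Ax) (b-min y By) }

Complete : ∀ {n} → Graph n → Set
Complete {n} G = ∀ {u v : Fin n} → u ≢ v → Adj G u v

module _ {n : ℕ} {G : Graph n} {f : Fin n → NSet} (weakIASI : IsWeakIASI G f) where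

  open IsWeakIASI weakIASI

  -- On an edge uv with 2 ≤ |f v| ≤ |f u|, the sumset would have more than
  -- |f u| = max(|f u|, |f v|) elements, contradicting weakness.
  larger-end-absorbs : ∀ {u v} → Adj G u v → ∀ k l → l ≤ k →
    HasSize (f u) (suc (suc k)) → HasSize (f v) (suc (suc l)) → ⊥
  larger-end-absorbs uv k l l≤k su sv with two-elements sv
  ... | _ , _ , b₀<b₁ , Bb₀ , Bb₁ =
    1+n≰n (subst (suc (suc (suc k)) ≤_) (m≥n⇒m⊔n≡m (s≤s (s≤s l≤k)))
      (sumset-grows su b₀<b₁ Bb₀ Bb₁ (weak _ _ uv _ _ su sv)))

  no-adjacent-multi : ∀ {u v} → Adj G u v → ∀ k l →
    HasSize (f u) (suc (suc k)) → HasSize (f v) (suc (suc l)) → ⊥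
  no-adjacent-multi uv k l su sv with ≤-total l k
  ... | inj₁ l≤k = larger-end-absorbs uv k l l≤k su sv
  ... | inj₂ k≤l = larger-end-absorbs (Graph.sym G uv) l k k≤l sv su

  private
    extra : Fin n → ℕ
    extra v = proj₁ (IsIASI.nonEmptyFinite iasi v)

    extra-size : ∀ v → HasSize (f v) (suc (extra v))
    extra-size v = proj₂ (IsIASI.nonEmptyFinite iasi v)

    mono : ∀ v → extra v ≡ 0 → HasSize (f v) 1
    mono v e = subst (λ k → HasSize (f v) (suc k)) e (extra-size v)

  -- In a complete graph, all vertices except possibly one are mono-indexed
  -- (the given default vertex serves as the exception when none is needed).
  all-but-one-mono : Complete G → Fin n → Σ (Fin n) λ b → ∀ v → v ≢ b → HasSize (f v) 1
  all-but-one-mono complete default with FinP.any? (λ v → 1 ≤? extra v)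
  ... | no none = default , λ v _ → mono v (n≤0⇒n≡0 (≮⇒≥ (λ pos → none (v , pos))))
  ... | yes (b , b-multi) =
    b , λ v v≢b → mono v (forced v v≢b (extra v) (extra b) (extra-size v) (extra-size b) b-multi)
    where
    forced : ∀ v → v ≢ b → ∀ k l → HasSize (f v) (suc k) → HasSize (f b) (suc l) → 1 ≤ l → k ≡ 0
    forced _ _   zero    _       _  _  _  = refl
    forced _ _   (suc k) zero    _  _  ()
    forced v v≢b (suc k) (suc l) sv sb _  = ⊥-elim (no-adjacent-multi (complete v≢b) k l sv sb)

pairCount : ℕ → ℕ
pairCount zero    = 0
pairCount (suc m) = m + pairCount m

pairCount-closed : ∀ m → pairCount m ≡ m * (m ∸ 1) / 2
pairCount-closed m = trans (≡.sym (m*n/n≡m (pairCount m) 2)) (cong (_/ 2) (twice m))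
  where
  step-identity : ∀ k → suc k * 2 + suc k * k ≡ suc (suc k) * suc k
  step-identity = solve-∀
  twice : ∀ m → pairCount m * 2 ≡ m * (m ∸ 1)
  twice zero          = refl
  twice (suc zero)    = refl
  twice (suc (suc k)) = trans (*-distribʳ-+ 2 (suc k) (pairCount (suc k)))
                              (trans (cong (suc k * 2 +_) (twice (suc k))) (step-identity k))

orderedPairs : (m : ℕ) → List (Fin m × Fin m)
orderedPairs zero    = []
orderedPairs (suc m) = map (λ j → fzero , fsuc j) (allFin m) ++ map shift (orderedPairs m)
  where
  shift : Fin m × Fin m → Fin (suc m) × Fin (suc m)
  shift (i , j) = fsuc i , fsuc j

orderedPairs-length : ∀ m → length (orderedPairs m) ≡ pairCount m
orderedPairs-length zero    = refl
orderedPairs-length (suc m) =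
  trans (length-++ (map (λ j → fzero , fsuc j) (allFin m)))
    (cong₂ _+_ (trans (length-map _ (allFin m)) (length-tabulate {n = m} (λ i → i)))
               (trans (length-map _ (orderedPairs m)) (orderedPairs-length m)))

orderedPairs-sound : ∀ m {i j : Fin m} → (i , j) ∈ orderedPairs m → i <ᶠ j
orderedPairs-sound (suc m) p∈ with ∈-++⁻ (map (λ j → fzero , fsuc j) (allFin m)) p∈
... | inj₁ p∈first with ∈-map⁻ _ p∈first
...   | _ , _ , refl = s≤s z≤n
orderedPairs-sound (suc m) p∈ | inj₂ p∈rest with ∈-map⁻ _ p∈rest
...   | _ , q∈ , refl = s≤s (orderedPairs-sound m q∈)

orderedPairs-complete : ∀ m {i j : Fin m} → i <ᶠ j → (i , j) ∈ orderedPairs m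
orderedPairs-complete (suc m) {fzero}  {fsuc j} _ = ∈-++⁺ˡ (∈-map⁺ (λ j → fzero , fsuc j) (∈-allFin j))
orderedPairs-complete (suc m) {fsuc i} {fsuc j} i<j =
  ∈-++⁺ʳ (map (λ j → fzero , fsuc j) (allFin m)) (∈-map⁺ _ (orderedPairs-complete m (s≤s⁻¹ i<j)))

orderedPairs-unique : ∀ m → Unique (orderedPairs m)
orderedPairs-unique zero    = []
orderedPairs-unique (suc m) =
  UniqueP.++⁺ (UniqueP.map⁺ (λ { refl → refl }) (UniqueP.allFin⁺ m))
              (UniqueP.map⁺ (λ { {_ , _} {_ , _} refl → refl }) (orderedPairs-unique m))
              disjoint
  where
  disjoint : ∀ {p} → ¬ (p ∈ map (λ j → fzero , fsuc j) (allFin m) × p ∈ map _ (orderedPairs m))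
  disjoint (p∈first , p∈rest) with ∈-map⁻ _ p∈first | ∈-map⁻ _ p∈rest
  ... | _ , _ , refl | (_ , _) , _ , ()

punchInPair : ∀ {m} → Fin (suc m) → Fin m × Fin m → Fin (suc m) × Fin (suc m)
punchInPair b (i , j) = punchIn b i , punchIn b j

punchInPair-injective : ∀ {m} (b : Fin (suc m)) {p q : Fin m × Fin m} → punchInPair b p ≡ punchInPair b q → p ≡ q
punchInPair-injective b {_ , _} {_ , _} e =
  cong₂ _,_ (FinP.punchIn-injective b _ _ (cong proj₁ e)) (FinP.punchIn-injective b _ _ (cong proj₂ e))

pairsAvoiding : ∀ {m} → Fin (suc m) → List (Fin (suc m) × Fin (suc m))
pairsAvoiding {m} b = map (punchInPair b) (orderedPairs m)

pairsAvoiding-length : ∀ {m} (b : Fin (suc m)) → length (pairsAvoiding b) ≡ pairCount m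
pairsAvoiding-length {m} b = trans (length-map (punchInPair b) (orderedPairs m)) (orderedPairs-length m)

pairsAvoiding-unique : ∀ {m} (b : Fin (suc m)) → Unique (pairsAvoiding b)
pairsAvoiding-unique {m} b = UniqueP.map⁺ (punchInPair-injective b) (orderedPairs-unique m)

pairsAvoiding-sound : ∀ {m} (b : Fin (suc m)) {u v} → (u , v) ∈ pairsAvoiding b →
                      u <ᶠ v × u ≢ b × v ≢ b
pairsAvoiding-sound {m} b p∈ with ∈-map⁻ (punchInPair b) p∈
... | (i , j) , q∈ , refl =
  FinP.≤∧≢⇒< (FinP.punchIn-mono-≤ b i j (<⇒≤ i<j)) (λ e → <⇒≢ i<j (cong toℕ (FinP.punchIn-injective b i j e))) ,
  FinP.punchInᵢ≢i b i , FinP.punchInᵢ≢i b j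
  where
  i<j : i <ᶠ j
  i<j = orderedPairs-sound m q∈

-- Any weak IASI of a complete graph on m + 1 vertices has at least
-- pairCount m mono-indexed edges: those avoiding the exceptional vertex.
sparing-lowerBound : ∀ {m} {G : Graph (suc m)} → Complete G →
  ∀ (f : Fin (suc m) → NSet) c → IsWeakIASI G f → MonoCount G f c → pairCount m ≤ c
sparing-lowerBound {m} {G} complete f c weakIASI (es , ues , refl , enum) =
  subst (_≤ length es) (pairsAvoiding-length b)
    (unique-⊆⇒length≤ (pairsAvoiding b) es (pairsAvoiding-unique b) mono-edge)
  where
  exceptional : Σ (Fin (suc m)) λ b → ∀ v → v ≢ b → HasSize (f v) 1
  exceptional = all-but-one-mono weakIASI complete fzero
  b : Fin (suc m)
  b = proj₁ exceptional
  mono-edge : ∀ {p} → p ∈ pairsAvoiding b → p ∈ es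
  mono-edge {u , v} p∈ with pairsAvoiding-sound b p∈
  ... | u<v , u≢b , v≢b =
    proj₂ (enum u v) (u<v , uv , IsWeakIASI.weak weakIASI u v uv 1 1
                                   (proj₂ exceptional u u≢b) (proj₂ exceptional v v≢b))
    where
    uv : Adj G u v
    uv = complete (λ u≡v → <⇒≢ u<v (cong toℕ u≡v))

2^-injective : ∀ {a b} → 2 ^ a ≡ 2 ^ b → a ≡ b
2^-injective {a} {b} e with <-cmp a b
... | tri< a<b _ _ = ⊥-elim (<⇒≢ (^-monoʳ-< 2 (s≤s (s≤s z≤n)) a<b) e)
... | tri≈ _ a≡b _ = a≡b
... | tri> _ _ b<a = ⊥-elim (>⇒≢ (^-monoʳ-< 2 (s≤s (s≤s z≤n)) b<a) e)

2^-sum-below : ∀ {a b} → a < b → 2 ^ a + 2 ^ b < 2 ^ suc b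
2^-sum-below {a} {b} a<b =
  subst (2 ^ a + 2 ^ b <_) (cong (2 ^ b +_) (≡.sym (+-identityʳ (2 ^ b))))
    (+-monoˡ-< (2 ^ b) (^-monoʳ-< 2 (s≤s (s≤s z≤n)) a<b))

-- As also 2^b ≤ 2^a + 2^b, the sum determines the larger exponent, hence both.
2^-sum-ordered : ∀ {a b c d} → a < b → c < d → 2 ^ a + 2 ^ b ≡ 2 ^ c + 2 ^ d → a ≡ c × b ≡ d
2^-sum-ordered {a} {b} {c} {d} a<b c<d e with <-cmp b d
... | tri< b<d _ _ =
  ⊥-elim (<⇒≢ (<-≤-trans (2^-sum-below a<b) (≤-trans (^-monoʳ-≤ 2 b<d) (m≤n+m (2 ^ d) (2 ^ c)))) e)
... | tri> _ _ d<b =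
  ⊥-elim (>⇒≢ (<-≤-trans (2^-sum-below c<d) (≤-trans (^-monoʳ-≤ 2 d<b) (m≤n+m (2 ^ b) (2 ^ a)))) e)
... | tri≈ _ refl _ = 2^-injective (+-cancelʳ-≡ (2 ^ b) (2 ^ a) (2 ^ c) e) , refl

2^-sidon : ∀ {a b c d} → a ≢ b → c ≢ d → 2 ^ a + 2 ^ b ≡ 2 ^ c + 2 ^ d →
           (a ≡ c × b ≡ d) ⊎ (a ≡ d × b ≡ c)
2^-sidon {a} {b} {c} {d} a≢b c≢d e with <-cmp a b | <-cmp c d
... | tri≈ _ a≡b _ | _              = ⊥-elim (a≢b a≡b)
... | _            | tri≈ _ c≡d _   = ⊥-elim (c≢d c≡d)
... | tri< a<b _ _ | tri< c<d _ _   = inj₁ (2^-sum-ordered a<b c<d e)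
... | tri< a<b _ _ | tri> _ _ d<c   =
  inj₂ (2^-sum-ordered a<b d<c (trans e (+-comm (2 ^ c) (2 ^ d))))
... | tri> _ _ b<a | tri< c<d _ _   =
  let (b≡c , a≡d) = 2^-sum-ordered b<a c<d (trans (+-comm (2 ^ b) (2 ^ a)) e) in inj₂ (a≡d , b≡c)
... | tri> _ _ b<a | tri> _ _ d<c   =
  let (b≡d , a≡c) = 2^-sum-ordered b<a d<c (trans (+-comm (2 ^ b) (2 ^ a)) (trans e (+-comm (2 ^ c) (2 ^ d))))
  in inj₁ (a≡c , b≡d)

powerLabel : ∀ {m} → Fin (suc m) → NSet
powerLabel fzero    y = y ≡ 1 ⊎ y ≡ 2
powerLabel (fsuc i) y = y ≡ 2 ^ toℕ (fsuc i)

labelSize : ∀ {m} → Fin (suc m) → ℕ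
labelSize fzero    = 2
labelSize (fsuc _) = 1

powerLabel-size : ∀ {m} (v : Fin (suc m)) → HasSize (powerLabel v) (labelSize v)
powerLabel-size fzero    = pair-size 1 2 (λ ())
powerLabel-size (fsuc i) = singleton-size _

powerLabel-min : ∀ {m} (v : Fin (suc m)) → IsMin (powerLabel v) (2 ^ toℕ v)
powerLabel-min fzero    = inj₁ refl , λ { _ (inj₁ refl) → ≤-refl ; _ (inj₂ refl) → s≤s z≤n }
powerLabel-min (fsuc i) = refl , λ { _ refl → ≤-refl }

-- Every edge label has the size of its larger end-label (a translate of it).
powerLabel-⊕-size : ∀ {m} (u v : Fin (suc m)) → u ≢ v →
                    HasSize (powerLabel u ⊕ powerLabel v) (labelSize u ⊔ labelSize v)
powerLabel-⊕-size     fzero    fzero    u≢v = ⊥-elim (u≢v refl)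
powerLabel-⊕-size {m} fzero    (fsuc j) _   = ⊕-singleton-size _ (powerLabel-size {m} fzero)
powerLabel-⊕-size {m} (fsuc i) fzero    _   =
  size-resp-≐ (⊕-comm (powerLabel {m} fzero) (powerLabel (fsuc i)))
              (⊕-singleton-size _ (powerLabel-size {m} fzero))
powerLabel-⊕-size     (fsuc i) (fsuc j) _   = ⊕-singleton-size _ (powerLabel-size (fsuc i))

-- The labelling is a weak IASI of every graph on m + 1 vertices: labels and
-- edge labels are recovered from their minima 2^v and 2^u + 2^v.
powerLabel-weakIASI : ∀ {m} (G : Graph (suc m)) → IsWeakIASI G powerLabel
powerLabel-weakIASI {m} G = record
  { iasi = record
    { nonEmptyFinite = nonEmpty
    ; injective      = λ u v e →
        FinP.toℕ-injective (2^-injective (min-unique e (powerLabel-min u) (powerLabel-min v)))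
    ; edgeInjective  = edgeInjective
    }
  ; weak = λ u v uv a b su sv →
      subst₂ (λ a b → HasSize (powerLabel u ⊕ powerLabel v) (a ⊔ b))
        (size-unique (powerLabel-size u) su) (size-unique (powerLabel-size v) sv)
        (powerLabel-⊕-size u v (adjacent-distinct uv))
  }
  where
  nonEmpty : ∀ v → ∃[ k ] HasSize (powerLabel v) (suc k)
  nonEmpty fzero    = 1 , powerLabel-size {m} fzero
  nonEmpty (fsuc i) = 0 , powerLabel-size (fsuc i)
  adjacent-distinct : ∀ {u v} → Adj G u v → u ≢ v
  adjacent-distinct uv refl = Graph.irrefl G uv
  toℕ-distinct : ∀ {u v} → Adj G u v → toℕ u ≢ toℕ v
  toℕ-distinct uv e = adjacent-distinct uv (FinP.toℕ-injective e)
  edgeInjective : ∀ u v w x → Adj G u v → Adj G w x →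
                  (powerLabel u ⊕ powerLabel v) ≐ (powerLabel w ⊕ powerLabel x) →
                  (u ≡ w × v ≡ x) ⊎ (u ≡ x × v ≡ w)
  edgeInjective u v w x uv wx e
    with 2^-sidon (toℕ-distinct uv) (toℕ-distinct wx)
           (min-unique e (min-⊕ (powerLabel-min u) (powerLabel-min v))
                         (min-⊕ (powerLabel-min w) (powerLabel-min x)))
  ... | inj₁ (u≡w , v≡x) = inj₁ (FinP.toℕ-injective u≡w , FinP.toℕ-injective v≡x)
  ... | inj₂ (u≡x , v≡w) = inj₂ (FinP.toℕ-injective u≡x , FinP.toℕ-injective v≡w)

powerLabel-monoCount : ∀ {m} {G : Graph (suc m)} → Complete G → MonoCount G powerLabel (pairCount m)
powerLabel-monoCount {m} {G} complete =
  pairsAvoiding vertex₀ , pairsAvoiding-unique vertex₀ , pairsAvoiding-length vertex₀ ,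
  λ u v → listed u v , mono⇒listed u v
  where
  vertex₀ : Fin (suc m)
  vertex₀ = fzero
  listed : ∀ u v → (u , v) ∈ pairsAvoiding vertex₀ → u <ᶠ v × Adj G u v × MonoEdge G powerLabel u v
  listed u v p∈ with pairsAvoiding-sound vertex₀ p∈ | ∈-map⁻ (punchInPair vertex₀) p∈
  ... | u<v , _ , _ | (i , j) , _ , refl =
    u<v , complete u≢v , powerLabel-⊕-size (fsuc i) (fsuc j) u≢v
    where
    u≢v : fsuc i ≢ fsuc j
    u≢v e = <⇒≢ u<v (cong toℕ e)
  mono⇒listed : ∀ u v → u <ᶠ v × Adj G u v × MonoEdge G powerLabel u v → (u , v) ∈ pairsAvoiding vertex₀
  mono⇒listed fzero    (fsuc j) (_ , _ , mono) =
    ⊥-elim (2≢1 (size-unique (powerLabel-⊕-size fzero (fsuc j) (λ ())) mono))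
    where
    2≢1 : 2 ≢ 1
    2≢1 ()
  mono⇒listed (fsuc i) (fsuc j) (i<j , _ , _) = ∈-map⁺ (punchInPair vertex₀) (orderedPairs-complete m (s≤s⁻¹ i<j))
  mono⇒listed _        fzero    (() , _ , _)

complete-sparingNumber : ∀ {m} {G : Graph (suc m)} → Complete G → SparingNumber G (pairCount m)
complete-sparingNumber {m} {G} complete =
  (powerLabel , powerLabel-weakIASI G , powerLabel-monoCount {m} {G} complete) ,
  sparing-lowerBound {m} {G} complete

power-complete : ∀ {n} r → r ≥ 1 → Complete (Power (K n) r)
power-complete r r≥1 u≢v = u≢v , 1 , r≥1 , step u≢v here

mainTheorem9 : ∀ (n r : ℕ) → n ≥ 1 → r ≥ 1 →
    SparingNumber (Power (K n) r) (((n ∸ 1) * (n ∸ 2)) / 2)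
mainTheorem9 (suc m) r _ r≥1 =
  subst (SparingNumber (Power (K (suc m)) r)) (pairCount-closed m)
    (complete-sparingNumber (power-complete r r≥1))
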